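{- Let $\Gamma$ be a finite simple connected graph with at least two vertices such that $\Gamma_2\cong\Gamma$, and suppose $\Gamma$ is not a cycle of odd length. Then $\Gamma$ has girth $3$, i.e. $\Gamma$ contains a triangle.
   Context: For a finite simple graph $\Gamma$ with path-distance $d$, the $2$-distance graph $\Gamma_2$ is the graph with vertex set $V(\Gamma)$ in which two distinct vertices $u,v$ are adjacent if and only if $d(u,v)=2$. A graph with $\Gamma_2\cong\Gamma$ is called a self $2$-distance graph. -}

module Defs where

open import Data.Nat using (ℕ; zero; suc; _+_; _*_; _<_; _≤_)
open import Data.Fin using (Fin; toℕ)
open import Data.Bool using (Bool; true; false)
open import Data.Sum using (_⊎_)
open import Data.Product using (Σ; ∃; _×_; _,_)
open import Relation.Binary.PropositionalEquality using (_≡_; _≢_)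
open import Relation.Nullary using (¬_)
open import Function.Bundles using (_⤖_; Bijection)

record Graph (n : ℕ) : Set where
  field
    adj   : Fin n → Fin n → Bool
    sym   : ∀ u v → adj u v ≡ adj v u
    irrefl : ∀ u → adj u u ≡ false
open Graph public

Adj : ∀ {n} → Graph n → Fin n → Fin n → Set
Adj G u v = adj G u v ≡ true

data Walk {n} (G : Graph n) : Fin n → Fin n → ℕ → Set where
  here : ∀ {u} → Walk G u u zero
  step : ∀ {u w v k} → Adj G u w → Walk G w v k → Walk G u v (suc k)

Dist≡ : ∀ {n} → Graph n → Fin n → Fin n → ℕ → Set
Dist≡ G u v k = Walk G u v k × (∀ j → j < k → ¬ Walk G u v j)

Connected : ∀ {n} → Graph n → Set
Connected G = ∀ u v → ∃ λ k → Walk G u v k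

_≅_ : ∀ {n m} → Graph n → Graph m → Set
_≅_ {n} {m} G H =
  Σ (Fin n ⤖ Fin m) λ f →
    ∀ u v → adj G u v ≡ adj H (Bijection.to f u) (Bijection.to f v)

Is2DistanceGraphOf : ∀ {n} → Graph n → Graph n → Set
Is2DistanceGraphOf G₂ G = ∀ u v → (Adj G₂ u v → u ≢ v × Dist≡ G u v 2)
                                 × (u ≢ v → Dist≡ G u v 2 → Adj G₂ u v)

cycleStep : ∀ {n} → Fin n → Fin n → Set
cycleStep {n} i j = (toℕ j ≡ suc (toℕ i)) ⊎ (suc (toℕ i) ≡ n × toℕ j ≡ 0)

cycleAdj : ∀ {n} → Fin n → Fin n → Set
cycleAdj i j = cycleStep i j ⊎ cycleStep j i

IsCycleGraph : ∀ {n} → Graph n → Set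
IsCycleGraph {n} G = 3 ≤ n × (∀ i j → Adj G i j → cycleAdj i j)
                           × (∀ i j → cycleAdj i j → Adj G i j)

Odd : ℕ → Set
Odd n = ∃ λ k → n ≡ suc (2 * k)

IsOddCycle : ∀ {n} → Graph n → Set
IsOddCycle {n} G = Σ (Graph n) λ C → IsCycleGraph C × Odd n × (G ≅ C)

HasTriangle : ∀ {n} → Graph n → Set
HasTriangle G = ∃ λ a → ∃ λ b → ∃ λ c → Adj G a b × Adj G b c × Adj G a c

module Submission where

-- Suppose Γ is triangle-free.  Then any two distinct neighbours of a vertex
-- are at distance 2, i.e. adjacent in Γ₂; three distinct neighbours would
-- therefore give a triangle in Γ₂ ≅ Γ.  So Γ has maximum degree at most 2.
-- A connected graph of maximum degree ≤ 2 is bipartite or an odd cycle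
-- ('bipartiteOrOddCycle'): follow the walk that never turns back, starting
-- at a leaf if there is one, until it first revisits a vertex; the vertices
-- met so far are all the vertices, and every edge joins cyclically
-- consecutive positions.  Colouring by the parity of the position is proper
-- unless the walk closes up into a cycle of odd length.  Finally, in a
-- bipartite graph vertices at distance 2 have equal colours, so the
-- connected graph Γ₂ ≅ Γ sees only one colour, and Γ has no edge at all,
-- which is impossible for a connected graph on two or more vertices.

open import Defs hiding (sym)
open import Data.Nat using (ℕ; _≤_)
open import Data.Product using (_×_)
open import Relation.Nullary using (¬_)

open import Data.Nat using (zero; suc; pred; _<_; s≤s; z≤n)
open import Data.Nat.Properties as ℕₚ using (anyUpTo?)
open import Data.Nat.Induction using (<-rec)
open import Data.Fin as Fin using (Fin; toℕ; fromℕ<)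
open import Data.Fin.Properties as Finₚ using (any?; all?)
open import Data.Bool using (Bool; true; false; not)
open import Data.Bool.Properties using (not-involutive; not-¬)
open import Data.Product using (Σ; ∃; _,_; proj₁; proj₂)
open import Data.Sum using (_⊎_; inj₁; inj₂; [_,_]; swap)
open import Data.Empty using (⊥-elim)
open import Relation.Unary using (Decidable)
open import Relation.Nullary using (Dec; yes; no; does; ¬?; contradiction)
open import Relation.Nullary.Decidable
  using (_×-dec_; _⊎-dec_; _→-dec_; map′; dec-true; dec-false; does-≡)
open import Relation.Binary using (tri<; tri≈; tri>)
open import Relation.Binary.PropositionalEquality
  using (_≡_; _≢_; refl; sym; trans; cong; cong₂; subst; subst₂)
open import Function.Bundles using (Bijection; mk↔ₛ′)
open import Function.Properties.Inverse using (↔⇒⤖)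

leastWitness : ∀ {P : ℕ → Set} → Decidable P → ∃ P →
               ∃ λ k → P k × (∀ {m} → m < k → ¬ P m)
leastWitness {P} P? (k , pk) = <-rec (λ k → P k → Least) search k pk
  where
  Least : Set
  Least = ∃ λ k → P k × (∀ {m} → m < k → ¬ P m)
  search : ∀ k → (∀ {m} → m < k → P m → Least) → P k → Least
  search k below pk with anyUpTo? P? k
  ... | yes (m , m<k , pm) = below m<k pm
  ... | no none            = k , pk , λ m<k pm → none (_ , m<k , pm)

parity : ℕ → Bool
parity zero    = false
parity (suc k) = not (parity k)

parity-odd : ∀ k → parity k ≡ true → Odd k
parity-odd (suc zero)    _  = 0 , refl
parity-odd (suc (suc k)) pk with parity-odd k (trans (sym (not-involutive (parity k))) pk)
... | t , refl = suc t , cong suc (sym (ℕₚ.*-suc 2 t))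

not-swap : ∀ {x y} → x ≡ not y → y ≡ not x
not-swap {y = y} x≡¬y = sym (trans (cong not x≡¬y) (not-involutive y))

reflects-does : ∀ {P : Set} (b : Bool) (P? : Dec P) →
                (b ≡ true → P) → (P → b ≡ true) → b ≡ does P?
reflects-does true  P? sound _        = sym (dec-true P? (sound refl))
reflects-does false P? _     complete = sym (dec-false P? λ p → not-¬ refl (complete p))

module _ {n : ℕ} (G : Graph n) where

  adj-sym : ∀ {u v} → Adj G u v → Adj G v u
  adj-sym {u} {v} e = trans (sym (Graph.sym G u v)) e

  adj-irrefl : ∀ {u} → ¬ Adj G u u
  adj-irrefl {u} e = not-¬ refl (trans (sym e) (Graph.irrefl G u))

  Adj? : ∀ u v → Dec (Adj G u v)
  Adj? u v = adj G u v Data.Bool.≟ true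

  hasTriangle? : Dec (HasTriangle G)
  hasTriangle? = any? λ a → any? λ b → any? λ c → Adj? a b ×-dec Adj? b c ×-dec Adj? a c

  MaxDegree≤2 : Set
  MaxDegree≤2 = ∀ {v a b c} → Adj G v a → Adj G v b → Adj G v c →
                a ≡ b ⊎ a ≡ c ⊎ b ≡ c

  Leaf : Fin n → Fin n → Set
  Leaf c p = ∀ y → Adj G c y → y ≡ p

  leaf? : Dec (∃ λ c → ∃ λ p → Adj G c p × Leaf c p)
  leaf? = any? λ c → any? λ p → Adj? c p ×-dec all? λ y → Adj? c y →-dec (y Finₚ.≟ p)

  Bipartite : Set
  Bipartite = Σ (Fin n → Bool) λ colour → ∀ {x y} → Adj G x y → colour y ≡ not (colour x)

  hasEdge : 2 ≤ n → Connected G → ∃ λ x → ∃ λ y → Adj G x y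
  hasEdge (s≤s (s≤s _)) conn with conn Fin.zero (Fin.suc Fin.zero)
  ... | _ , step e _ = _ , _ , e

module _ {n m : ℕ} (G : Graph n) (H : Graph m) (iso : G ≅ H) where

  private
    f : Fin n → Fin m
    f = Bijection.to (proj₁ iso)

  iso-adj : ∀ {u v} → Adj G u v → Adj H (f u) (f v)
  iso-adj {u} {v} e = trans (sym (proj₂ iso u v)) e

  iso-connected : Connected H → Connected G
  iso-connected conn a b = let (k , w) = conn (f a) (f b) in k , pull w a b refl refl
    where
    pre : Fin m → Fin n
    pre y = proj₁ (proj₂ (Bijection.bijective (proj₁ iso)) y)
    f-pre : ∀ y → f (pre y) ≡ y
    f-pre y = proj₂ (proj₂ (Bijection.bijective (proj₁ iso)) y) refl
    pull : ∀ {y z k} → Walk H y z k → ∀ a b → f a ≡ y → f b ≡ z → Walk G a b k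
    pull here a b fa fb with proj₁ (Bijection.bijective (proj₁ iso)) (trans fa (sym fb))
    ... | refl = here
    pull (step {w = w} e rest) a b fa fb = step a~pre (pull rest (pre w) b (f-pre w) fb)
      where
      a~pre : Adj G a (pre w)
      a~pre = trans (proj₂ iso a (pre w)) (trans (cong₂ (adj H) fa (f-pre w)) e)

-- Cyclic adjacency of positions modulo m; 'cycleAdj {m}' is this relation
-- on the values of its arguments.
CyclicStep : ℕ → ℕ → ℕ → Set
CyclicStep m a b = b ≡ suc a ⊎ (suc a ≡ m × b ≡ 0)

CyclicAdj : ℕ → ℕ → ℕ → Set
CyclicAdj m a b = CyclicStep m a b ⊎ CyclicStep m b a

cycleAdj? : ∀ {n} (i k : Fin n) → Dec (cycleAdj i k)
cycleAdj? {n} i k = step? i k ⊎-dec step? k i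
  where
  step? : (i k : Fin n) → Dec (cycleStep i k)
  step? i k = (toℕ k ℕₚ.≟ suc (toℕ i)) ⊎-dec ((suc (toℕ i) ℕₚ.≟ n) ×-dec (toℕ k ℕₚ.≟ 0))

cycleAdj-irrefl : ∀ {n} → 3 ≤ n → (i : Fin n) → ¬ cycleAdj i i
cycleAdj-irrefl 3≤n i = [ no-loop , no-loop ]
  where
  no-loop : ¬ cycleStep i i
  no-loop (inj₁ i≡1+i)     = ℕₚ.1+n≢n (sym i≡1+i)
  no-loop (inj₂ (1+i≡n , i≡0)) = 3≰1 (subst (3 ≤_) (trans (sym 1+i≡n) (cong suc i≡0)) 3≤n)
    where
    3≰1 : ¬ 3 ≤ 1
    3≰1 (s≤s ())

cycleGraph : (n : ℕ) → 3 ≤ n → Graph n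
cycleGraph n 3≤n = record
  { adj    = λ i k → does (cycleAdj? i k)
  ; sym    = λ i k → does-≡ (cycleAdj? i k) (map′ swap swap (cycleAdj? k i))
  ; irrefl = λ i → dec-false (cycleAdj? i i) (cycleAdj-irrefl 3≤n i)
  }

cycleGraph-isCycle : ∀ n (3≤n : 3 ≤ n) → IsCycleGraph (cycleGraph n 3≤n)
cycleGraph-isCycle n 3≤n =
  3≤n , (λ i k e → decided (cycleAdj? i k) e) , (λ i k c → dec-true (cycleAdj? i k) c)
  where
  decided : ∀ {P : Set} (P? : Dec P) → does P? ≡ true → P
  decided (yes p) _  = p
  decided (no _)  ()

enumeratedCycle : ∀ {n} (G : Graph n) (3≤n : 3 ≤ n) (t : Fin n → Fin n) →
  (∀ {x y} → t x ≡ t y → x ≡ y) → (∀ v → ∃ λ x → t x ≡ v) →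
  (∀ x y → Adj G (t x) (t y) → cycleAdj x y) →
  (∀ x y → cycleAdj x y → Adj G (t x) (t y)) →
  G ≅ cycleGraph n 3≤n
enumeratedCycle G 3≤n t t-inj t-onto sound complete =
  ↔⇒⤖ (mk↔ₛ′ position t position-t t-position) , adj-position
  where
  position : Fin _ → Fin _
  position v = proj₁ (t-onto v)
  t-position : ∀ v → t (position v) ≡ v
  t-position v = proj₂ (t-onto v)
  position-t : ∀ x → position (t x) ≡ x
  position-t x = t-inj (t-position (t x))
  adj-position : ∀ u v → adj G u v ≡ does (cycleAdj? (position u) (position v))
  adj-position u v = reflects-does (adj G u v) (cycleAdj? (position u) (position v))
    (λ e → sound _ _ (subst₂ (Adj G) (sym (t-position u)) (sym (t-position v)) e))
    (λ c → subst₂ (Adj G) (t-position u) (t-position v) (complete _ _ c))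

-- Connected graphs of maximum degree at most 2

module NonBacktrackingWalk {n} (G : Graph n) (deg : MaxDegree≤2 G) (conn : Connected G)
                           (x₀ x₁ : Fin n) (x₀x₁ : Adj G x₀ x₁) where

  onward? : ∀ p c → Dec (∃ λ y → Adj G c y × y ≢ p)
  onward? p c = any? λ y → Adj? G c y ×-dec ¬? (y Finₚ.≟ p)

  next : Fin n → Fin n → Fin n
  next p c with onward? p c
  ... | yes (y , _) = y
  ... | no _        = p

  next-spec : ∀ p c → Adj G c p →
              Adj G c (next p c) × (∀ y → Adj G c y → y ≡ p ⊎ y ≡ next p c)
                                 × (next p c ≡ p → Leaf G c p)
  next-spec p c cp with onward? p c
  ... | yes (q , cq , q≢p) = cq , neighbours , λ q≡p → ⊥-elim (q≢p q≡p)
    where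
    neighbours : ∀ y → Adj G c y → y ≡ p ⊎ y ≡ q
    neighbours y cy with deg cp cq cy
    ... | inj₁ p≡q        = ⊥-elim (q≢p (sym p≡q))
    ... | inj₂ (inj₁ p≡y) = inj₁ (sym p≡y)
    ... | inj₂ (inj₂ q≡y) = inj₂ (sym q≡y)
  ... | no none = cp , (λ y cy → inj₁ (only y cy)) , λ _ → only
    where
    only : Leaf G c p
    only y cy with y Finₚ.≟ p
    ... | yes y≡p = y≡p
    ... | no y≢p  = ⊥-elim (none (y , cy , y≢p))

  walk : ℕ → Fin n
  walk zero                = x₀
  walk (suc zero)          = x₁
  walk (suc (suc k))       = next (walk k) (walk (suc k))

  chain : ∀ k → Adj G (walk k) (walk (suc k))
  chain zero    = x₀x₁
  chain (suc k) = proj₁ (next-spec (walk k) (walk (suc k)) (adj-sym G (chain k)))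

  neighbours : ∀ k y → Adj G (walk (suc k)) y → y ≡ walk k ⊎ y ≡ walk (suc (suc k))
  neighbours k = proj₁ (proj₂ (next-spec (walk k) (walk (suc k)) (adj-sym G (chain k))))

  bounce : ∀ k → walk (suc (suc k)) ≡ walk k → Leaf G (walk (suc k)) (walk k)
  bounce k = proj₂ (proj₂ (next-spec (walk k) (walk (suc k)) (adj-sym G (chain k))))

  Revisit : ℕ → Set
  Revisit b = ∃ λ a → a < b × walk a ≡ walk b

  -- By pigeonhole the walk revisits a vertex; j is the first such position
  -- and i the earlier position of the same vertex.
  opaque
    firstRevisit : ∃ λ j → Revisit j × (∀ {b} → b < j → ¬ Revisit b)
    firstRevisit = leastWitness (λ b → anyUpTo? (λ a → walk a Finₚ.≟ walk b) b) revisit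
      where
      revisit : ∃ Revisit
      revisit with Finₚ.pigeonhole (ℕₚ.n<1+n n) (λ k → walk (toℕ k))
      ... | a , b , a<b , eq = toℕ b , toℕ a , a<b , eq

  j : ℕ
  j = proj₁ firstRevisit

  i : ℕ
  i = proj₁ (proj₁ (proj₂ firstRevisit))

  i<j : i < j
  i<j = proj₁ (proj₂ (proj₁ (proj₂ firstRevisit)))

  walk-i≡walk-j : walk i ≡ walk j
  walk-i≡walk-j = proj₂ (proj₂ (proj₁ (proj₂ firstRevisit)))

  injective : ∀ {a b} → a < j → b < j → walk a ≡ walk b → a ≡ b
  injective {a} {b} a<j b<j eq with ℕₚ.<-cmp a b
  ... | tri< a<b _ _ = ⊥-elim (proj₂ (proj₂ firstRevisit) b<j (a , a<b , eq))
  ... | tri≈ _ a≡b _ = a≡b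
  ... | tri> _ _ b<a = ⊥-elim (proj₂ (proj₂ firstRevisit) a<j (b , b<a , sym eq))

  2≤j : 2 ≤ j
  2≤j = shape i j i<j walk-i≡walk-j
    where
    shape : ∀ a b → a < b → walk a ≡ walk b → 2 ≤ b
    shape zero          (suc zero)    _          eq =
      ⊥-elim (adj-irrefl G (subst (λ x → Adj G x x₁) eq x₀x₁))
    shape (suc _)       (suc zero)    (s≤s ())   _
    shape _             (suc (suc _)) _          _  = s≤s (s≤s z≤n)

  suc-pred-j : suc (pred j) ≡ j
  suc-pred-j with j | 2≤j
  ... | suc _ | _ = refl

  pred-j<j : pred j < j
  pred-j<j = subst (pred j <_) suc-pred-j ℕₚ.≤-refl

  revisitShape : ∀ a b → a < b → b ≤ j → walk a ≡ walk b →
                 a ≡ 0 ⊎ (b ≡ suc (suc a) × Leaf G (walk (suc a)) (walk a))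
  revisitShape zero     _       _         _   _  = inj₁ refl
  revisitShape (suc a) (suc b) (s≤s a<b) b<j eq
    with neighbours a (walk b) (subst (λ x → Adj G x (walk b)) (sym eq) (adj-sym G (chain b)))
  ... | inj₁ wb≡wa = ⊥-elim (ℕₚ.<-irrefl (sym (injective b<j (ℕₚ.<-trans a<b b<j) wb≡wa)) a<b)
  ... | inj₂ wb≡wa+2 with ℕₚ.m≤n⇒m<n∨m≡n a<b
  ...   | inj₂ refl = ⊥-elim (adj-irrefl G (subst (λ x → Adj G x (walk (suc b))) eq (chain b)))
  ...   | inj₁ a+1<b with injective b<j (ℕₚ.<-≤-trans (s≤s a+1<b) b<j) wb≡wa+2
  ...     | refl = inj₂ (refl , bounce (suc a) (sym eq))

  WellStarted : Set
  WellStarted = ∀ y → Adj G x₀ y → y ≡ walk 1 ⊎ y ≡ walk (pred j)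

  leafStart : Leaf G x₀ x₁ → WellStarted
  leafStart leaf y e = inj₁ (leaf y e)

  module _ (noLeaf : ∀ {c p} → Adj G c p → ¬ Leaf G c p) where

    returnsToStart : walk j ≡ x₀
    returnsToStart with revisitShape i j i<j ℕₚ.≤-refl walk-i≡walk-j
    ... | inj₁ i≡0        = trans (sym walk-i≡walk-j) (cong walk i≡0)
    ... | inj₂ (_ , leaf) = ⊥-elim (noLeaf (adj-sym G (chain i)) leaf)

    closingEdge : Adj G x₀ (walk (pred j))
    closingEdge = adj-sym G (subst (Adj G (walk (pred j)))
                    (trans (cong walk suc-pred-j) returnsToStart) (chain (pred j)))

    -- The closed walk has length at least 3: length 2 would be a bounce.
    x₁≢last : x₁ ≢ walk (pred j)
    x₁≢last x₁≡last = noLeaf (adj-sym G x₀x₁) (bounce 0 (trans (cong walk 2≡j) returnsToStart))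
      where
      2≡j : 2 ≡ j
      2≡j = trans (cong suc (sym (injective pred-j<j 2≤j (sym x₁≡last)))) suc-pred-j

    -- Without leaves the walk cannot bounce, so it closes up at x₀, and
    -- x₀'s two walk-neighbours are all its neighbours.
    noLeafStart : WellStarted
    noLeafStart y e with deg x₀x₁ closingEdge e
    ... | inj₁ x₁≡last       = ⊥-elim (x₁≢last x₁≡last)
    ... | inj₂ (inj₁ x₁≡y)   = inj₁ (sym x₁≡y)
    ... | inj₂ (inj₂ last≡y) = inj₂ (sym last≡y)

  module Classification (start : WellStarted) where

    neighbourPosition : ∀ a y → a < j → Adj G (walk a) y →
                        ∃ λ b → b < j × walk b ≡ y × CyclicAdj j a b
    neighbourPosition zero y _ e with start y e
    ... | inj₁ y≡x₁   = 1 , 2≤j , sym y≡x₁ , inj₁ (inj₁ refl)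
    ... | inj₂ y≡last = pred j , pred-j<j , sym y≡last , inj₂ (inj₂ (suc-pred-j , refl))
    neighbourPosition (suc a) y a<j e with neighbours a y e
    ... | inj₁ y≡prev = a , ℕₚ.<-trans (ℕₚ.n<1+n a) a<j , sym y≡prev , inj₂ (inj₁ refl)
    ... | inj₂ y≡next with ℕₚ.m≤n⇒m<n∨m≡n a<j
    ...   | inj₁ a+2<j = suc (suc a) , a+2<j , sym y≡next , inj₁ (inj₁ refl)
    ...   | inj₂ a+2≡j = i , i<j , walk-i≡y , wraps
      where
      walk-i≡y : walk i ≡ y
      walk-i≡y = trans walk-i≡walk-j (trans (cong walk (sym a+2≡j)) (sym y≡next))
      wraps : CyclicAdj j (suc a) i
      wraps with revisitShape i j i<j ℕₚ.≤-refl walk-i≡walk-j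
      ... | inj₁ i≡0        = inj₁ (inj₂ (a+2≡j , i≡0))
      ... | inj₂ (j≡i+2 , _) = inj₂ (inj₁ (ℕₚ.suc-injective (trans a+2≡j j≡i+2)))

    Listed : Fin n → Set
    Listed x = ∃ λ a → a < j × walk a ≡ x

    listed : ∀ v → Listed v
    listed v = along (proj₂ (conn x₀ v)) (0 , ℕₚ.<-trans (s≤s z≤n) 2≤j , refl)
      where
      along : ∀ {x v k} → Walk G x v k → Listed x → Listed v
      along here                  listed-x           = listed-x
      along (step {w = w} e rest) (a , a<j , refl) =
        along rest (let (b , b<j , wb , _) = neighbourPosition a w a<j e in b , b<j , wb)

    position : Fin n → ℕ
    position v = proj₁ (listed v)

    position<j : ∀ v → position v < j
    position<j v = proj₁ (proj₂ (listed v))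

    walk-position : ∀ v → walk (position v) ≡ v
    walk-position v = proj₂ (proj₂ (listed v))

    atPositions : ∀ {x y} → Adj G x y → Adj G (walk (position x)) (walk (position y))
    atPositions {x} {y} = subst₂ (Adj G) (sym (walk-position x)) (sym (walk-position y))

    edgePositions : ∀ {a b} → a < j → b < j → Adj G (walk a) (walk b) → CyclicAdj j a b
    edgePositions {a} {b} a<j b<j e with neighbourPosition a (walk b) a<j e
    ... | b′ , b′<j , wb′ , adjacent with injective b′<j b<j wb′
    ...   | refl = adjacent

    parityBipartite : (Adj G (walk (pred j)) x₀ → parity j ≡ false) → Bipartite G
    parityBipartite evenIfClosed = colour , proper
      where
      colour : Fin n → Bool
      colour v = parity (position v)
      stepFlips : ∀ {a b} → CyclicStep j a b → Adj G (walk a) (walk b) → parity b ≡ not (parity a)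
      stepFlips (inj₁ refl) _ = refl
      stepFlips (inj₂ (a+1≡j , refl)) e =
        sym (subst (λ m → parity m ≡ false) (sym a+1≡j)
              (evenIfClosed (subst (λ m → Adj G (walk m) x₀) (cong pred a+1≡j) e)))
      proper : ∀ {x y} → Adj G x y → colour y ≡ not (colour x)
      proper {x} {y} e with edgePositions (position<j x) (position<j y) (atPositions e)
      ... | inj₁ forward  = stepFlips forward (atPositions e)
      ... | inj₂ backward = not-swap (stepFlips backward (atPositions (adj-sym G e)))

    oddCycle : parity j ≡ true → Adj G (walk (pred j)) x₀ → IsOddCycle G
    oddCycle odd closing =
      cycleGraph n 3≤n , cycleGraph-isCycle n 3≤n ,
      parity-odd n (subst (λ m → parity m ≡ true) j≡n odd) ,
      enumeratedCycle G 3≤n t t-inj t-onto sound complete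
      where
      j≡n : j ≡ n
      j≡n = ℕₚ.≤-antisym
        (Finₚ.injective⇒≤ {f = λ (x : Fin j) → walk (toℕ x)}
          λ eq → Finₚ.toℕ-injective (injective (Finₚ.toℕ<n _) (Finₚ.toℕ<n _) eq))
        (Finₚ.injective⇒≤ {f = λ v → fromℕ< (position<j v)}
          λ {u} {v} eq → trans (sym (walk-position u))
                               (trans (cong walk (positions eq)) (walk-position v)))
        where
        positions : ∀ {u v} → fromℕ< (position<j u) ≡ fromℕ< (position<j v) → position u ≡ position v
        positions {u} {v} eq = trans (sym (Finₚ.toℕ-fromℕ< (position<j u)))
                                     (trans (cong toℕ eq) (Finₚ.toℕ-fromℕ< (position<j v)))
      3≤n : 3 ≤ n
      3≤n = subst (3 ≤_) j≡n (ℕₚ.≤∧≢⇒< 2≤j λ 2≡j → not-¬ refl (trans (cong parity 2≡j) odd))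
      below-j : ∀ (x : Fin n) → toℕ x < j
      below-j x = subst (toℕ x <_) (sym j≡n) (Finₚ.toℕ<n x)
      t : Fin n → Fin n
      t x = walk (toℕ x)
      t-inj : ∀ {x y} → t x ≡ t y → x ≡ y
      t-inj {x} {y} eq = Finₚ.toℕ-injective (injective (below-j x) (below-j y) eq)
      t-onto : ∀ v → ∃ λ x → t x ≡ v
      t-onto v = fromℕ< position<n , trans (cong walk (Finₚ.toℕ-fromℕ< position<n)) (walk-position v)
        where
        position<n : position v < n
        position<n = subst (position v <_) j≡n (position<j v)
      sound : ∀ x y → Adj G (t x) (t y) → cycleAdj x y
      sound x y e =
        subst (λ m → CyclicAdj m (toℕ x) (toℕ y)) j≡n (edgePositions (below-j x) (below-j y) e)
      stepEdge : ∀ {a b} → CyclicStep j a b → Adj G (walk a) (walk b)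
      stepEdge {a} (inj₁ refl)            = chain a
      stepEdge     (inj₂ (a+1≡j , refl)) =
        subst (λ m → Adj G (walk m) x₀) (sym (cong pred a+1≡j)) closing
      complete : ∀ x y → cycleAdj x y → Adj G (t x) (t y)
      complete x y (inj₁ forward)  =
        stepEdge (subst (λ m → CyclicStep m (toℕ x) (toℕ y)) (sym j≡n) forward)
      complete x y (inj₂ backward) =
        adj-sym G (stepEdge (subst (λ m → CyclicStep m (toℕ y) (toℕ x)) (sym j≡n) backward))

    classify : Bipartite G ⊎ IsOddCycle G
    classify with parity j in parity-j
    ... | false = inj₁ (parityBipartite λ _ → parity-j)
    ... | true with Adj? G (walk (pred j)) x₀
    ...   | yes closing = inj₂ (oddCycle parity-j closing)
    ...   | no unclosed = inj₁ (parityBipartite λ closing → contradiction closing unclosed)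

bipartiteOrOddCycle : ∀ {n} (G : Graph n) → Connected G → MaxDegree≤2 G →
                      ∀ {x y} → Adj G x y → Bipartite G ⊎ IsOddCycle G
bipartiteOrOddCycle G conn deg {x} {y} e with leaf? G
... | yes (c , p , cp , leaf) = Classification.classify (leafStart leaf)
  where open NonBacktrackingWalk G deg conn c p cp
... | no noLeaf = Classification.classify (noLeafStart λ cp leaf → noLeaf (_ , _ , cp , leaf))
  where open NonBacktrackingWalk G deg conn x y e

-- Self 2-distance graphs

module _ {n : ℕ} (Γ Γ₂ : Graph n) (d2 : Is2DistanceGraphOf Γ₂ Γ) where

  commonNeighbour-dist2 : ¬ HasTriangle Γ → ∀ {v a b} → Adj Γ v a → Adj Γ v b → a ≢ b →
                          Dist≡ Γ a b 2
  commonNeighbour-dist2 noTri {v} {a} {b} va vb a≢b = step (adj-sym Γ va) (step vb here) , shorter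
    where
    shorter : ∀ k → k < 2 → ¬ Walk Γ a b k
    shorter zero          _                 here           = a≢b refl
    shorter (suc zero)    _                 (step ab here) = noTri (a , v , b , adj-sym Γ va , vb , ab)
    shorter (suc (suc _)) (s≤s (s≤s ()))    _

  -- Three distinct neighbours of a vertex would be pairwise adjacent in
  -- Γ₂ ≅ Γ, hence form a triangle of Γ.
  maxDegree≤2 : ¬ HasTriangle Γ → Γ₂ ≅ Γ → MaxDegree≤2 Γ
  maxDegree≤2 noTri iso {v} {a} {b} {c} va vb vc with a Finₚ.≟ b | a Finₚ.≟ c | b Finₚ.≟ c
  ... | yes a≡b | _       | _       = inj₁ a≡b
  ... | no _    | yes a≡c | _       = inj₂ (inj₁ a≡c)
  ... | no _    | no _    | yes b≡c = inj₂ (inj₂ b≡c)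
  ... | no a≢b  | no a≢c  | no b≢c  =
    ⊥-elim (noTri (_ , _ , _ , apart va vb a≢b , apart vb vc b≢c , apart va vc a≢c))
    where
    apart : ∀ {x y} → Adj Γ v x → Adj Γ v y → x ≢ y →
            Adj Γ (Bijection.to (proj₁ iso) x) (Bijection.to (proj₁ iso) y)
    apart vx vy x≢y =
      iso-adj Γ₂ Γ iso (proj₂ (d2 _ _) x≢y (commonNeighbour-dist2 noTri vx vy x≢y))

  -- Vertices at distance 2 in a bipartite graph have equal colours; if Γ₂ is
  -- connected, all vertices do, so a bipartite Γ has no edges.
  bipartite-edgeless : Bipartite Γ → Connected Γ₂ → ∀ {x y} → ¬ Adj Γ x y
  bipartite-edgeless (colour , proper) conn₂ {x} {y} e =
    not-¬ refl (trans (sym (alongΓ₂ (proj₂ (conn₂ x y)))) (proper e))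
    where
    alongΓ₂ : ∀ {u v k} → Walk Γ₂ u v k → colour v ≡ colour u
    alongΓ₂ here = refl
    alongΓ₂ {u} (step {w = w} e₂ rest) with proj₁ (proj₂ (proj₁ (d2 u w) e₂))
    ... | step uz (step zw here) =
      trans (alongΓ₂ rest)
            (trans (proper zw) (trans (cong not (proper uz)) (not-involutive (colour u))))

lemma2p4 : (n : ℕ) → (Γ Γ₂ : Graph n) → 2 ≤ n → Connected Γ
    → Is2DistanceGraphOf Γ₂ Γ → Γ₂ ≅ Γ → ¬ IsOddCycle Γ → HasTriangle Γ
lemma2p4 n Γ Γ₂ 2≤n conn d2 iso notOddCycle with hasTriangle? Γ
... | yes triangle = triangle
... | no noTriangle
  with (x , y , xy) ← hasEdge Γ 2≤n conn
  with bipartiteOrOddCycle Γ conn (maxDegree≤2 Γ Γ₂ d2 noTriangle iso) xy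
...   | inj₁ bipartite =
  ⊥-elim (bipartite-edgeless Γ Γ₂ d2 bipartite (iso-connected Γ₂ Γ iso conn) xy)
...   | inj₂ oddCycle  = ⊥-elim (notOddCycle oddCycle)
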